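{- Let $N,k,e\in\mathbb{N}$ and let $r$ be an odd prime with $\gcd(Nk,r)=1$, and assume $(k^{ -1}N\,|\,r)=1$. Then there are exactly two elements $a,b\in\mathcal{L}_{N,r^e,k}$ with $\nu_a\ge e/2$ and $\nu_b\ge e/2$, and they satisfy $\nu_a=\nu_b=\lceil e/2\rceil$.
   Context: $(\cdot|\cdot)$ is the Legendre symbol and $k^{ -1}$ the inverse of $k$ modulo $r$. $\mathcal{H}_{N,m}:=\{(x,y)\in(\mathbb{Z}/m\mathbb{Z})^2: xy\equiv N \bmod m\}$ and, for $\gcd(Nk,m)=1$, $\mathcal{L}_{N,m,k}:=\{kx+y\bmod m:(x,y)\in\mathcal{H}_{N,m}\}$. For $a\in\mathcal{L}_{N,r^e,k}$ let $\mathcal{P}_a:=\{(x,y)\in\mathcal{H}_{N,r^e}: a\equiv kx+y\bmod r^e\}$; for $(x,y)\in\mathcal{P}_a$, $\nu_r(kx-y)$ is the largest $j\in\{0,\dots,e\}$ with $r^j\mid kx-y$; and $\nu_a:=\min\{\nu_r(kx-y):(x,y)\in\mathcal{P}_a\}$. -}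

module Defs where

open import Data.Nat as ℕ using (ℕ; zero; suc; _<_; _≤_; _^_; _⊓_; _*_; _+_)
import Data.Nat.Divisibility as ℕD
open import Data.Integer as ℤ using (ℤ; +_; 0ℤ; 1ℤ; -1ℤ)
open import Data.Integer.Divisibility using (_∣_)
open import Data.List using (List; []; _∷_; upTo; map; foldr; concatMap)
open import Data.Bool.ListAction using (any)
open import Data.Product using (_×_; _,_; ∃-syntax)
open import Data.Bool using (Bool; true; false; if_then_else_; _∧_)
open import Relation.Nullary using (Dec; does)

_≡_[mod_] : ℤ → ℤ → ℕ → Set
a ≡ b [mod m ] = (+ m) ∣ (a ℤ.- b)

_≡?_[mod_] : (a b : ℤ) (m : ℕ) → Dec (a ≡ b [mod m ])
a ≡? b [mod m ] = m ℕD.∣? ℤ.∣ a ℤ.- b ∣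

legendre : ℤ → ℕ → ℤ
legendre a r =
  if does (r ℕD.∣? ℤ.∣ a ∣) then 0ℤ
  else if any (λ x → does ((+ x ℤ.* + x) ≡? a [mod r ])) (upTo r) then 1ℤ
  else -1ℤ

-- Residues of ℤ/mℤ are represented by their canonical representatives x < m.

InH : (N m x y : ℕ) → Set
InH N m x y = x < m × y < m × (+ (x * y)) ≡ (+ N) [mod m ]

InL : (N m k a : ℕ) → Set
InL N m k a = a < m × ∃[ x ] ∃[ y ] (InH N m x y × (+ (k * x + y)) ≡ (+ a) [mod m ])

InP : (N m k a x y : ℕ) → Set
InP N m k a x y = InH N m x y × (+ a) ≡ (+ (k * x + y)) [mod m ]

νr : (r e : ℕ) → ℤ → ℕ
νr r e d = go e
  where
  go : ℕ → ℕ
  go zero    = zero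
  go (suc j) = if does ((r ^ suc j) ℕD.∣? ℤ.∣ d ∣) then suc j else go j

-- ν_a := min { ν_r(kx - y) : (x , y) ∈ P_a }, where the ambient modulus is r^e.
-- (All values are ≤ e, so starting the fold at e gives the true minimum when
--  P_a ≠ ∅; for P_a = ∅, i.e. a ∉ L, the value e is an irrelevant default.)
νa : (N k r e a : ℕ) → ℕ
νa N k r e a = foldr _⊓_ e (map val (concatMap (λ x → map (x ,_) (upTo m)) (upTo m)))
  where
  m = r ^ e
  inP : ℕ → ℕ → Bool
  inP x y = does ((+ (x * y)) ≡? (+ N) [mod m ]) ∧ does ((+ a) ≡? (+ (k * x + y)) [mod m ])
  val : ℕ × ℕ → ℕ
  val (x , y) = if inP x y then νr r e (+ (k * x) ℤ.- + y) else e

-- For (x, y) ∈ P_a the identity (kx - y)² = (kx + y)² - 4k·xy gives (kx - y)² ≡ a² - 4kN (mod r^e).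
-- So ν_a ≥ e/2 forces a² ≡ 4kN; conversely, if a² ≡ 4kN then r^e ∣ (kx - y)², hence r^⌈e/2⌉ ∣ kx - y
-- for every (x, y) ∈ P_a, since r is prime. As k⁻¹N is a square mod r, Hensel's lemma lifts a root of
-- k x² ≡ N to a root x₀ modulo r^e, and the solutions of a² ≡ 4kN ≡ (2kx₀)² are exactly a ≡ ±2kx₀:
-- r ∤ 2·2kx₀, so r cannot divide both a - 2kx₀ and a + 2kx₀, and 2kx₀ ≢ -2kx₀. For a ≡ 2kx₀ the pair
-- (x₀ + r^⌈e/2⌉, k(x₀ - r^⌈e/2⌉)) lies in P_a with kx - y ≡ 2k·r^⌈e/2⌉, so ν_a is exactly ⌈e/2⌉.

module Submission where

open import Defs

-- ℤ's _*_ and the signed _∣_ are opened only inside this module; the theorem below uses ℕ's.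
module _ where

  open import Data.Bool using (true; false; T; if_then_else_; _∧_)
  open import Data.Bool.ListAction using (any)
  open import Data.Integer using (ℤ; +_; -[1+_]; -_; _+_; _-_; _*_; 0ℤ; 1ℤ; ∣_∣)
  open import Data.Integer.DivMod using (_%ℕ_; _/ℕ_; n%ℕd<d; a≡a%ℕn+[a/ℕn]*n)
  open import Data.Integer.Divisibility.Signed
  open import Data.Integer.Properties using (pos-+; pos-*; abs-*; neg-distribʳ-*; [+m]-[+n]≡m⊖n; ∣⊖∣-≤)
  open import Data.Integer.Tactic.RingSolver using (solve)
  open import Data.List using (List; []; _∷_; map; foldr; upTo; concatMap)
  open import Data.List.Membership.Propositional using (_∈_)
  open import Data.List.Membership.Propositional.Properties using (∈-map⁺; ∈-concatMap⁺; ∈-upTo⁺)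
  import Data.List.Relation.Unary.Any as Any
  open import Data.List.Relation.Unary.Any using (here; there)
  open import Data.List.Relation.Unary.Any.Properties using (any⁻)
  open import Data.Nat as ℕ using (ℕ; zero; suc; _<_; _≤_; _^_; _⊓_; z≤n; s≤s; ⌈_/2⌉; NonZero)
  import Data.Nat.Divisibility as ℕ
  open import Data.Nat.Coprimality using (Coprime; coprime-Bézout)
  open import Data.Nat.GCD using (module Bézout)
  open import Data.Nat.Primality using (Prime; euclidsLemma; prime⇒irreducible; prime⇒nonZero; prime⇒nonTrivial; prime[2])
  import Data.Nat.Properties as ℕ
  import Data.Nat.Tactic.RingSolver as ℕ-Solver
  open import Data.Product using (_×_; _,_; ∃-syntax; proj₁; proj₂)
  open import Data.Sum as Sum using (_⊎_; inj₁; inj₂)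
  open import Data.Unit using (tt)
  open import Function using (_∘_; _∋_)
  open import Relation.Binary.Bundles using (Setoid)
  open import Relation.Binary.PropositionalEquality using (_≡_; _≢_; refl; sym; trans; cong; cong₂; subst; module ≡-Reasoning)
  import Relation.Binary.Reasoning.Setoid as SetoidReasoning
  open import Relation.Nullary using (¬_; Dec; yes; no; does; contradiction)
  open import Relation.Nullary.Decidable using (dec-true)

  ℕ∣⇒ℤ∣ : ∀ {a b} → a ℕ.∣ b → + a ∣ + b
  ℕ∣⇒ℤ∣ = ∣ᵤ⇒∣

  -- Unlike Defs._≡_[mod_], which unfolds to ℕ-divisibility of ∣ a - b ∣, this record keeps a and b inferable.
  infix 4 _≈_[mod_]
  record _≈_[mod_] (a b : ℤ) (m : ℕ) : Set where
    constructor divides-diff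
    field ∣-diff : + m ∣ a - b
  open _≈_[mod_] public

  module _ {m : ℕ} where

    ∣-≡ : ∀ {i j} → + m ∣ i → i ≡ j → + m ∣ j
    ∣-≡ d refl = d

    ≈-refl : ∀ {a} → a ≈ a [mod m ]
    ≈-refl {a} = divides-diff (∣-≡ (divides 0ℤ refl) (solve (a ∷ [])))

    ≈-reflexive : ∀ {a b} → a ≡ b → a ≈ b [mod m ]
    ≈-reflexive refl = ≈-refl

    ≈-sym : ∀ {a b} → a ≈ b [mod m ] → b ≈ a [mod m ]
    ≈-sym {a} {b} (divides-diff d) = divides-diff (∣-≡ (∣m⇒∣-m d) (solve (a ∷ b ∷ [])))

    ≈-trans : ∀ {a b c} → a ≈ b [mod m ] → b ≈ c [mod m ] → a ≈ c [mod m ]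
    ≈-trans {a} {b} {c} (divides-diff d) (divides-diff d′) =
      divides-diff (∣-≡ (∣m∣n⇒∣m+n d d′) (solve (a ∷ b ∷ c ∷ [])))

    ≈-setoid : Setoid _ _
    ≈-setoid = record
      { Carrier = ℤ ; _≈_ = _≈_[mod m ]
      ; isEquivalence = record { refl = ≈-refl ; sym = ≈-sym ; trans = ≈-trans } }

    +-cong : ∀ {a b c d} → a ≈ b [mod m ] → c ≈ d [mod m ] → a + c ≈ b + d [mod m ]
    +-cong {a} {b} {c} {d} (divides-diff d₁) (divides-diff d₂) =
      divides-diff (∣-≡ (∣m∣n⇒∣m+n d₁ d₂) (solve (a ∷ b ∷ c ∷ d ∷ [])))

    -‿cong : ∀ {a b} → a ≈ b [mod m ] → - a ≈ - b [mod m ]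
    -‿cong {a} {b} (divides-diff d) = divides-diff (∣-≡ (∣m⇒∣-m d) (solve (a ∷ b ∷ [])))

    *-cong : ∀ {a b c d} → a ≈ b [mod m ] → c ≈ d [mod m ] → a * c ≈ b * d [mod m ]
    *-cong {a} {b} {c} {d} (divides-diff d₁) (divides-diff d₂) =
      divides-diff (∣-≡ (∣m∣n⇒∣m+n (∣m⇒∣m*n c d₁) (∣n⇒∣m*n b d₂)) (solve (a ∷ b ∷ c ∷ d ∷ [])))

    ≈0⇒∣ : ∀ {a} → a ≈ 0ℤ [mod m ] → + m ∣ a
    ≈0⇒∣ {a} (divides-diff d) = ∣-≡ d (solve (a ∷ []))

    ∣⇒≈0 : ∀ {a} → + m ∣ a → a ≈ 0ℤ [mod m ]
    ∣⇒≈0 {a} d = divides-diff (∣-≡ d (solve (a ∷ [])))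

    ∣-resp-≈ : ∀ {a b} → + m ∣ a → a ≈ b [mod m ] → + m ∣ b
    ∣-resp-≈ {a} {b} m∣a (divides-diff m∣a-b) = ∣-≡ (∣m∣n⇒∣m-n m∣a m∣a-b) (solve (a ∷ b ∷ []))

    ≡mod⇒≈ : ∀ {a b} → a ≡ b [mod m ] → a ≈ b [mod m ]
    ≡mod⇒≈ = divides-diff ∘ ∣ᵤ⇒∣

    ≈⇒≡mod : ∀ {a b} → a ≈ b [mod m ] → a ≡ b [mod m ]
    ≈⇒≡mod = ∣⇒∣ᵤ ∘ ∣-diff

  module ≈-Reasoning (m : ℕ) = SetoidReasoning (≈-setoid {m})

  ≈-weaken : ∀ {n m a b} → n ℕ.∣ m → a ≈ b [mod m ] → a ≈ b [mod n ]
  ≈-weaken n∣m (divides-diff d) = divides-diff (∣-trans (ℕ∣⇒ℤ∣ n∣m) d)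

  %ℕ-≈ : ∀ z m .{{_ : NonZero m}} → + (z %ℕ m) ≈ z [mod m ]
  %ℕ-≈ z m = divides-diff (divides (- (z /ℕ m)) (r-z≡-qM (+ (z %ℕ m)) (z /ℕ m) (+ m) (a≡a%ℕn+[a/ℕn]*n z m)))
    where
    r-z≡-qM : ∀ r q M → z ≡ r + q * M → r - z ≡ - q * M
    r-z≡-qM r q M refl = solve (r ∷ q ∷ M ∷ [])

  ∣∧<⇒≡0 : ∀ {m n} → m ℕ.∣ n → n < m → n ≡ 0
  ∣∧<⇒≡0 {n = zero}  _   _   = refl
  ∣∧<⇒≡0 {n = suc _} m∣n n<m = contradiction m∣n (ℕ.>⇒∤ n<m)

  ≤-residues⇒≡ : ∀ {m x y} → x ≤ y → y < m → + x ≈ + y [mod m ] → x ≡ y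
  ≤-residues⇒≡ {m} {x} {y} x≤y y<m (divides-diff d) =
    ℕ.≤-antisym x≤y (ℕ.m∸n≡0⇒m≤n (∣∧<⇒≡0 m∣y∸x (ℕ.≤-<-trans (ℕ.m∸n≤m y x) y<m)))
    where
    m∣y∸x : m ℕ.∣ y ℕ.∸ x
    m∣y∸x = subst (m ℕ.∣_) (trans (cong ∣_∣ ([+m]-[+n]≡m⊖n x y)) (∣⊖∣-≤ x≤y)) (∣⇒∣ᵤ d)

  ≈-residues⇒≡ : ∀ {m x y} → x < m → y < m → + x ≈ + y [mod m ] → x ≡ y
  ≈-residues⇒≡ {x = x} {y} x<m y<m x≈y with ℕ.≤-total x y
  ... | inj₁ x≤y = ≤-residues⇒≡ x≤y y<m x≈y
  ... | inj₂ y≤x = sym (≤-residues⇒≡ y≤x x<m (≈-sym x≈y))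

  ^-monoʳ-∣ : ∀ p {i j} → i ≤ j → p ^ i ℕ.∣ p ^ j
  ^-monoʳ-∣ p {i} {j} i≤j =
    subst (p ^ i ℕ.∣_) (trans (sym (ℕ.^-distribˡ-+-* p i (j ℕ.∸ i))) (cong (p ^_) (ℕ.m+[n∸m]≡n i≤j)))
      (ℕ.m∣m*n _)

  pos-1+* : ∀ a b c d → 1 ℕ.+ a ℕ.* b ≡ c ℕ.* d → 1ℤ + + a * + b ≡ + c * + d
  pos-1+* a b c d eq = begin
    1ℤ + + a * + b     ≡⟨ cong (λ t → 1ℤ + t) (pos-* a b) ⟨
    + (1 ℕ.+ a ℕ.* b)  ≡⟨ cong +_ eq ⟩
    + (c ℕ.* d)        ≡⟨ pos-* c d ⟩
    + c * + d          ∎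
    where open ≡-Reasoning

  m∣m^n : ∀ m {n} → 1 ≤ n → m ℕ.∣ m ^ n
  m∣m^n m {suc n} _ = ℕ.m∣m*n (m ^ n)

  ≉-neg : ∀ {p e a} → 1 ≤ e → ¬ (+ p ∣ + 2 * a) → ¬ (a ≈ - a [mod p ^ e ])
  ≉-neg {p} {e} {a} 1≤e p∤2a (divides-diff pᵉ∣a--a) =
    p∤2a (∣-≡ (∣-trans (ℕ∣⇒ℤ∣ (m∣m^n p 1≤e)) pᵉ∣a--a) (solve (a ∷ [])))

  *-pres-∣ : ∀ {a b c d} → a ∣ b → c ∣ d → a * c ∣ b * d
  *-pres-∣ {a} {c = c} (divides q refl) (divides q′ refl) = divides (q * q′) (solve (q ∷ a ∷ q′ ∷ c ∷ []))

  pos-*+ : ∀ k x y → + (k ℕ.* x ℕ.+ y) ≡ + k * + x + + y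
  pos-*+ k x y = trans (pos-+ (k ℕ.* x) y) (cong (_+ + y) (pos-* k x))

  n≤2*⌈n/2⌉ : ∀ n → n ≤ 2 ℕ.* ⌈ n /2⌉
  n≤2*⌈n/2⌉ n = begin
    n                               ≡⟨ ℕ.⌊n/2⌋+⌈n/2⌉≡n n ⟨
    ℕ.⌊ n /2⌋ ℕ.+ ⌈ n /2⌉          ≤⟨ ℕ.+-monoˡ-≤ ⌈ n /2⌉ (ℕ.⌊n/2⌋≤⌈n/2⌉ n) ⟩
    ⌈ n /2⌉ ℕ.+ ⌈ n /2⌉            ≡⟨ cong (⌈ n /2⌉ ℕ.+_) (ℕ.+-identityʳ ⌈ n /2⌉) ⟨
    2 ℕ.* ⌈ n /2⌉                  ∎
    where open ℕ.≤-Reasoning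

  m≤2*n⇒⌈m/2⌉≤n : ∀ {m n} → m ≤ 2 ℕ.* n → ⌈ m /2⌉ ≤ n
  m≤2*n⇒⌈m/2⌉≤n {m} {n} m≤2n = begin
    ⌈ m /2⌉             ≤⟨ ℕ.⌈n/2⌉-mono m≤2n ⟩
    ⌈ n ℕ.+ (n ℕ.+ 0) /2⌉ ≡⟨ cong (λ t → ⌈ n ℕ.+ t /2⌉) (ℕ.+-identityʳ n) ⟩
    ⌈ n ℕ.+ n /2⌉        ≡⟨ ℕ.n≡⌈n+n/2⌉ n ⟨
    n                    ∎
    where open ℕ.≤-Reasoning

  m^n∣m^⌈n/2⌉*m^⌈n/2⌉ : ∀ p e → + (p ^ e) ∣ + (p ^ ⌈ e /2⌉) * + (p ^ ⌈ e /2⌉)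
  m^n∣m^⌈n/2⌉*m^⌈n/2⌉ p e = subst (+ (p ^ e) ∣_) (pos-* (p ^ ⌈ e /2⌉) (p ^ ⌈ e /2⌉))
    (ℕ∣⇒ℤ∣ (subst (p ^ e ℕ.∣_) (ℕ.^-distribˡ-+-* p ⌈ e /2⌉ ⌈ e /2⌉)
      (^-monoʳ-∣ p (subst (e ≤_) (cong (⌈ e /2⌉ ℕ.+_) (ℕ.+-identityʳ ⌈ e /2⌉)) (n≤2*⌈n/2⌉ e)))))

  module _ {p : ℕ} (p-prime : Prime p) where

    private instance
      p≢0 : NonZero p
      p≢0 = prime⇒nonZero p-prime

    prime-power-divisor : ∀ {m n} j → ¬ p ℕ.∣ m → p ^ j ℕ.∣ m ℕ.* n → p ^ j ℕ.∣ n
    prime-power-divisor zero    _   _ = ℕ.1∣ _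
    prime-power-divisor {m} {n} (suc j) p∤m pʲ⁺¹∣mn
      with euclidsLemma m n p-prime (ℕ.∣-trans (ℕ.m∣m*n (p ^ j)) pʲ⁺¹∣mn)
    ... | inj₁ p∣m = contradiction p∣m p∤m
    ... | inj₂ (ℕ.divides q refl) =
      subst (p ^ suc j ℕ.∣_) (ℕ.*-comm p q) (ℕ.*-monoʳ-∣ p (prime-power-divisor j p∤m pʲ∣mq))
      where
      pʲ∣mq : p ^ j ℕ.∣ m ℕ.* q
      pʲ∣mq = ℕ.*-cancelˡ-∣ p (subst (p ^ suc j ℕ.∣_) mqp≡pmq pʲ⁺¹∣mn)
        where
        mqp≡pmq : m ℕ.* (q ℕ.* p) ≡ p ℕ.* (m ℕ.* q)
        mqp≡pmq = ℕ-Solver.solve (m ∷ q ∷ p ∷ [])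

    prime-∣-square : ∀ {n} → p ℕ.∣ n ℕ.* n → p ℕ.∣ n
    prime-∣-square {n} p∣nn = Sum.reduce (euclidsLemma n n p-prime p∣nn)

    prime-power-∣-square : ∀ e {n} → p ^ e ℕ.∣ n ℕ.* n → p ^ ⌈ e /2⌉ ℕ.∣ n
    prime-power-∣-square zero          _ = ℕ.1∣ _
    prime-power-∣-square (suc zero) {n} p¹∣nn =
      subst (ℕ._∣ n) (sym (ℕ.*-identityʳ p)) (prime-∣-square (ℕ.m*n∣⇒m∣ p 1 p¹∣nn))
    prime-power-∣-square (suc (suc e)) {n} pᵉ⁺²∣nn with prime-∣-square {n} (ℕ.∣-trans (ℕ.m∣m*n _) pᵉ⁺²∣nn)
    ... | ℕ.divides q refl =
      subst (p ^ suc ⌈ e /2⌉ ℕ.∣_) (ℕ.*-comm p q) (ℕ.*-monoʳ-∣ p (prime-power-∣-square e pᵉ∣qq))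
      where
      pᵉ∣qq : p ^ e ℕ.∣ q ℕ.* q
      pᵉ∣qq = ℕ.*-cancelˡ-∣ p (ℕ.*-cancelˡ-∣ p
        (subst (p ^ suc (suc e) ℕ.∣_) qpqp≡ppqq pᵉ⁺²∣nn))
        where
        qpqp≡ppqq : q ℕ.* p ℕ.* (q ℕ.* p) ≡ p ℕ.* (p ℕ.* (q ℕ.* q))
        qpqp≡ppqq = ℕ-Solver.solve (q ∷ p ∷ [])

    prime-power-divisor-ℤ : ∀ {u v} j → ¬ (+ p ∣ u) → + (p ^ j) ∣ u * v → + (p ^ j) ∣ v
    prime-power-divisor-ℤ {u} {v} j p∤u pʲ∣uv =
      ∣ᵤ⇒∣ (prime-power-divisor j (p∤u ∘ ∣ᵤ⇒∣) (subst (p ^ j ℕ.∣_) (abs-* u v) (∣⇒∣ᵤ pʲ∣uv)))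

    prime-power-∣-square-ℤ : ∀ e {d} → + (p ^ e) ∣ d * d → + (p ^ ⌈ e /2⌉) ∣ d
    prime-power-∣-square-ℤ e {d} pᵉ∣dd =
      ∣ᵤ⇒∣ (prime-power-∣-square e (subst (p ^ e ℕ.∣_) (abs-* d d) (∣⇒∣ᵤ pᵉ∣dd)))

    prime-∤-* : ∀ {a b} → ¬ (+ p ∣ a) → ¬ (+ p ∣ b) → ¬ (+ p ∣ a * b)
    prime-∤-* {a} {b} p∤a p∤b p∣ab
      with euclidsLemma ∣ a ∣ ∣ b ∣ p-prime (subst (p ℕ.∣_) (abs-* a b) (∣⇒∣ᵤ p∣ab))
    ... | inj₁ p∣a = p∤a (∣ᵤ⇒∣ p∣a)
    ... | inj₂ p∣b = p∤b (∣ᵤ⇒∣ p∣b)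

    square-roots-mod-prime-power : ∀ e {a c} → ¬ (+ p ∣ + 2 * a) → c * c ≈ a * a [mod p ^ e ] →
                                   c ≈ a [mod p ^ e ] ⊎ c ≈ - a [mod p ^ e ]
    square-roots-mod-prime-power e {a} {c} p∤2a c²≈a² = cases (+ p ∣? c - a)
      where
      pᵉ∣[c-a][c+a] : + (p ^ e) ∣ (c - a) * (c + a)
      pᵉ∣[c-a][c+a] = ∣-≡ (∣-diff c²≈a²) (solve (c ∷ a ∷ []))
      cases : Dec (+ p ∣ c - a) → c ≈ a [mod p ^ e ] ⊎ c ≈ - a [mod p ^ e ]
      cases (yes p∣c-a) =
        inj₁ (divides-diff (prime-power-divisor-ℤ e p∤c+a (∣-≡ pᵉ∣[c-a][c+a] (solve (c ∷ a ∷ [])))))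
        where
        p∤c+a : ¬ (+ p ∣ c + a)
        p∤c+a p∣c+a = p∤2a (∣-≡ (∣m∣n⇒∣m-n p∣c+a p∣c-a) (solve (c ∷ a ∷ [])))
      cases (no p∤c-a) =
        inj₂ (divides-diff (∣-≡ (prime-power-divisor-ℤ e p∤c-a pᵉ∣[c-a][c+a]) (solve (c ∷ a ∷ []))))

    ∤⇒coprime : ∀ {n} → ¬ p ℕ.∣ n → Coprime p n
    ∤⇒coprime p∤n (d∣p , d∣n) with prime⇒irreducible p-prime d∣p
    ... | inj₁ d≡1 = d≡1
    ... | inj₂ refl = contradiction d∣n p∤n

    inverse-mod-prime-ℕ : ∀ {n} → ¬ p ℕ.∣ n → ∃[ w ] w * + n ≈ 1ℤ [mod p ]
    inverse-mod-prime-ℕ {n} p∤n with coprime-Bézout (∤⇒coprime p∤n)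
    ... | Bézout.+- x y eq =
      - + y , divides-diff (divides (- + x) (rearranged (+ y) (+ n) (+ x) (+ p) (pos-1+* y n x p eq)))
      where
      rearranged : ∀ Y N X P → 1ℤ + Y * N ≡ X * P → (- Y) * N - 1ℤ ≡ (- X) * P
      rearranged Y N X P e = begin
        (- Y) * N - 1ℤ ≡⟨ solve (Y ∷ N ∷ []) ⟩
        - (1ℤ + Y * N) ≡⟨ cong -_ e ⟩
        - (X * P)      ≡⟨ solve (X ∷ P ∷ []) ⟩
        (- X) * P      ∎
        where open ≡-Reasoning
    ... | Bézout.-+ x y eq =
      + y , divides-diff (divides (+ x) (rearranged (+ y) (+ n) (+ x) (+ p) (pos-1+* x p y n eq)))
      where
      rearranged : ∀ Y N X P → 1ℤ + X * P ≡ Y * N → Y * N - 1ℤ ≡ X * P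
      rearranged Y N X P e = begin
        Y * N - 1ℤ          ≡⟨ cong (_- 1ℤ) e ⟨
        1ℤ + X * P - 1ℤ     ≡⟨ solve (X ∷ P ∷ []) ⟩
        X * P               ∎
        where open ≡-Reasoning

    inverse-mod-prime : ∀ {u} → ¬ (+ p ∣ u) → ∃[ w ] w * u ≈ 1ℤ [mod p ]
    inverse-mod-prime {+ n}      p∤u = inverse-mod-prime-ℕ (p∤u ∘ ∣ᵤ⇒∣)
    inverse-mod-prime { -[1+ n ]} p∤u with inverse-mod-prime-ℕ (p∤u ∘ ∣ᵤ⇒∣)
    ... | w , w*v≈1 = - w , ≈-trans (≈-reflexive (neg*neg w (+ suc n))) w*v≈1
      where
      neg*neg : ∀ w v → (- w) * (- v) ≡ w * v
      neg*neg w v = solve (w ∷ v ∷ [])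

  prime∤coprime : ∀ {p n} → Prime p → Coprime n p → ¬ p ℕ.∣ n
  prime∤coprime p-prime n⊥p p∣n = ℕ.nonTrivial⇒≢1 {{prime⇒nonTrivial p-prime}} (n⊥p (p∣n , ℕ.∣-refl))

  odd-prime∤2 : ∀ {p} → Prime p → ¬ 2 ℕ.∣ p → ¬ p ℕ.∣ 2
  odd-prime∤2 p-prime 2∤p p∣2 with prime⇒irreducible prime[2] p∣2
  ... | inj₁ refl = ℕ.nonTrivial⇒≢1 {{prime⇒nonTrivial p-prime}} refl
  ... | inj₂ refl = 2∤p ℕ.∣-refl

  module Quadratic (K N : ℤ) where

    F : ℤ → ℤ
    F x = K * (x * x) - N

    neg-root : ∀ {m} x → + m ∣ F x → + m ∣ F (- x)
    neg-root {m} x m∣Fx = ∣-≡ m∣Fx ((K * (x * x) - N ≡ K * (- x * - x) - N) ∋ solve (K ∷ N ∷ x ∷ []))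

    square-of-difference : ∀ {m X Y C} → X * Y ≈ N [mod m ] → C ≈ K * X + Y [mod m ] →
                           (K * X - Y) * (K * X - Y) ≈ C * C - + 4 * K * N [mod m ]
    square-of-difference {m} {X} {Y} {C} XY≈N C≈KX+Y = begin
      (K * X - Y) * (K * X - Y)                      ≡⟨ solve (K ∷ X ∷ Y ∷ []) ⟩
      (K * X + Y) * (K * X + Y) - + 4 * K * (X * Y)
        ≈⟨ +-cong (*-cong (≈-sym C≈KX+Y) (≈-sym C≈KX+Y)) (-‿cong (*-cong (≈-refl {a = + 4 * K}) XY≈N)) ⟩
      C * C - + 4 * K * N                            ∎
      where open ≈-Reasoning m

    root-square : ∀ {m A} x → + m ∣ F x → A ≈ + 2 * K * x [mod m ] → A * A ≈ + 4 * K * N [mod m ]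
    root-square {m} {A} x m∣Fx A≈2Kx = begin
      A * A                                   ≈⟨ *-cong A≈2Kx A≈2Kx ⟩
      (+ 2 * K * x) * (+ 2 * K * x)           ≡⟨ solve (K ∷ N ∷ x ∷ []) ⟩
      + 4 * K * (K * (x * x) - N) + + 4 * K * N ≈⟨ +-cong (*-cong (≈-refl {a = + 4 * K}) (∣⇒≈0 m∣Fx)) ≈-refl ⟩
      + 4 * K * 0ℤ + + 4 * K * N              ≡⟨ solve (K ∷ N ∷ []) ⟩
      + 4 * K * N                             ∎
      where open ≈-Reasoning m

    inverse-square-root⇒root : ∀ {m w X} → w * K ≈ 1ℤ [mod m ] → X * X ≈ w * N [mod m ] → + m ∣ F X
    inverse-square-root⇒root {m} {w} {X} wK≈1 XX≈wN = ≈0⇒∣ (begin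
      K * (X * X) - N    ≈⟨ +-cong (*-cong (≈-refl {a = K}) XX≈wN) ≈-refl ⟩
      K * (w * N) - N    ≡⟨ solve (K ∷ N ∷ w ∷ []) ⟩
      (w * K) * N - N    ≈⟨ +-cong (*-cong wK≈1 (≈-refl {a = N})) ≈-refl ⟩
      1ℤ * N - N         ≡⟨ solve (N ∷ []) ⟩
      0ℤ                 ∎)
      where open ≈-Reasoning m

    module _ {m X Y} (x P : ℤ) (X≈x+P : X ≈ x + P [mod m ]) (Y≈K[x-P] : Y ≈ K * (x - P) [mod m ]) where

      shifted-sum : K * X + Y ≈ + 2 * K * x [mod m ]
      shifted-sum = begin
        K * X + Y                   ≈⟨ +-cong (*-cong (≈-refl {a = K}) X≈x+P) Y≈K[x-P] ⟩
        K * (x + P) + K * (x - P)   ≡⟨ solve (K ∷ x ∷ P ∷ []) ⟩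
        + 2 * K * x                 ∎
        where open ≈-Reasoning m

      shifted-difference : K * X - Y ≈ + 2 * K * P [mod m ]
      shifted-difference = begin
        K * X - Y                   ≈⟨ +-cong (*-cong (≈-refl {a = K}) X≈x+P) (-‿cong Y≈K[x-P]) ⟩
        K * (x + P) - K * (x - P)   ≡⟨ solve (K ∷ x ∷ P ∷ []) ⟩
        + 2 * K * P                 ∎
        where open ≈-Reasoning m

      shifted-product : + m ∣ F x → + m ∣ P * P → X * Y ≈ N [mod m ]
      shifted-product m∣Fx m∣PP = begin
        X * Y                                  ≈⟨ *-cong X≈x+P Y≈K[x-P] ⟩
        (x + P) * (K * (x - P))                ≡⟨ solve (K ∷ N ∷ x ∷ P ∷ []) ⟩
        (K * (x * x) - N) + N - K * (P * P)
          ≈⟨ +-cong (+-cong (∣⇒≈0 m∣Fx) (≈-refl {a = N})) (-‿cong (*-cong (≈-refl {a = K}) (∣⇒≈0 m∣PP))) ⟩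
        0ℤ + N - K * 0ℤ                        ≡⟨ solve (K ∷ N ∷ []) ⟩
        N                                      ∎
        where open ≈-Reasoning m

    -- F (x - w F x) = (1 - w F′ x) F x + K w² (F x)², and p divides 1 - w F′ x, where F′ x = 2Kx.
    newton-step : ∀ {p x w} j → w * (+ 2 * K * x) ≈ 1ℤ [mod p ] →
                  + (p ^ suc j) ∣ F x → + (p ^ suc (suc j)) ∣ F (x - w * F x)
    newton-step {p} {x} {w} j w-inverse pʲ⁺¹∣Fx = ∣-≡ (∣m∣n⇒∣m+n linear quadratic) taylor
      where
      taylor : (1ℤ - w * (+ 2 * K * x)) * (K * (x * x) - N)
                 + K * (w * w) * ((K * (x * x) - N) * (K * (x * x) - N))
             ≡ K * ((x - w * (K * (x * x) - N)) * (x - w * (K * (x * x) - N))) - N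
      taylor = solve (K ∷ N ∷ x ∷ w ∷ [])
      linear : + (p ^ suc (suc j)) ∣ (1ℤ - w * (+ 2 * K * x)) * F x
      linear = subst (_∣ _) (sym (pos-* p (p ^ suc j))) (*-pres-∣ (∣-diff (≈-sym w-inverse)) pʲ⁺¹∣Fx)
      pʲ⁺²∣pʲ⁺¹*pʲ⁺¹ : p ^ suc (suc j) ℕ.∣ p ^ suc j ℕ.* p ^ suc j
      pʲ⁺²∣pʲ⁺¹*pʲ⁺¹ = subst (p ^ suc (suc j) ℕ.∣_) (ℕ.^-distribˡ-+-* p (suc j) (suc j))
                         (^-monoʳ-∣ p (s≤s (ℕ.m≤n+m (suc j) j)))
      quadratic : + (p ^ suc (suc j)) ∣ K * (w * w) * (F x * F x)
      quadratic = ∣n⇒∣m*n (K * (w * w))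
        (∣-trans (subst (+ (p ^ suc (suc j)) ∣_) (pos-* (p ^ suc j) (p ^ suc j)) (ℕ∣⇒ℤ∣ pʲ⁺²∣pʲ⁺¹*pʲ⁺¹))
                 (*-pres-∣ pʲ⁺¹∣Fx pʲ⁺¹∣Fx))

    module _ {p : ℕ} (p-prime : Prime p) (p∤2 : ¬ (+ p ∣ + 2)) (p∤K : ¬ (+ p ∣ K)) (p∤N : ¬ (+ p ∣ N)) where

      root-∤ : ∀ {x} → + p ∣ F x → ¬ (+ p ∣ x)
      root-∤ {x} p∣Fx p∣x = p∤N (∣-≡ (∣m∣n⇒∣m-n (∣n⇒∣m*n K (∣m⇒∣m*n x p∣x)) p∣Fx) Kx²-Fx≡N)
        where
        Kx²-Fx≡N : K * (x * x) - (K * (x * x) - N) ≡ N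
        Kx²-Fx≡N = solve (K ∷ N ∷ x ∷ [])

      hensel-lift : ∀ {x} → + p ∣ F x → ∀ j → ∃[ y ] + (p ^ suc j) ∣ F y
      hensel-lift {x} p∣Fx zero = x , subst (_∣ F x) (cong +_ (sym (ℕ.*-identityʳ p))) p∣Fx
      hensel-lift {x} p∣Fx (suc j) with hensel-lift {x} p∣Fx j
      ... | y , pʲ⁺¹∣Fy = y - w * F y , newton-step {x = y} {w} j w-inverse pʲ⁺¹∣Fy
        where
        p∤2Ky : ¬ (+ p ∣ + 2 * K * y)
        p∤2Ky = prime-∤-* p-prime (prime-∤-* p-prime p∤2 p∤K)
                  (root-∤ {y} (∣-trans (ℕ∣⇒ℤ∣ (ℕ.m∣m*n (p ^ j))) pʲ⁺¹∣Fy))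
        w = proj₁ (inverse-mod-prime p-prime p∤2Ky)
        w-inverse = proj₂ (inverse-mod-prime p-prime p∤2Ky)

  T-does⇒ : ∀ {A : Set} (A? : Dec A) → T (does A?) → A
  T-does⇒ (yes a) _ = a

  legendre≡1⇒square : ∀ a r → legendre a r ≡ 1ℤ → ∃[ x ] (+ x * + x) ≡ a [mod r ]
  legendre≡1⇒square a r legendre≡1
    with r ℕ.∣? ∣ a ∣ | any (λ x → does ((+ x * + x) ≡? a [mod r ])) (upTo r) in squares
  ... | yes _ | _     = contradiction legendre≡1 λ ()
  ... | no _  | false = contradiction legendre≡1 λ ()
  ... | no _  | true with Any.satisfied (any⁻ _ (upTo r) (subst T (sym squares) tt))
  ...   | x , x²≡a = x , T-does⇒ ((+ x * + x) ≡? a [mod r ]) x²≡a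

  -- Defs.νr runs a local function of Defs that has no name outside it. The underscore is solved to that
  -- function by unification in νr-unfold, where `with suc e` makes its arguments distinct variables.
  mutual
    νr-search : ℕ → ℕ → ℤ → ℕ → ℕ
    νr-search = _

    νr-unfold : ∀ r e d →
                νr r (suc e) d ≡ (if does (r ^ suc e ℕ.∣? ∣ d ∣) then suc e else νr-search r (suc e) d e)
    νr-unfold r e d with r ^ suc e ℕ.∣? ∣ d ∣
    ... | yes _ = refl
    ... | no _ with suc e
    ...   | e′ = refl

  module _ (r e : ℕ) (d : ℤ) where

    νr-search-∣ : ∀ j → r ^ νr-search r e d j ℕ.∣ ∣ d ∣
    νr-search-∣ zero = ℕ.1∣ _
    νr-search-∣ (suc j) with r ^ suc j ℕ.∣? ∣ d ∣
    ... | yes rʲ⁺¹∣d = rʲ⁺¹∣d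
    ... | no  _      = νr-search-∣ j

    νr-search-≤ : ∀ j → νr-search r e d j ≤ j
    νr-search-≤ zero = z≤n
    νr-search-≤ (suc j) with r ^ suc j ℕ.∣? ∣ d ∣
    ... | yes _ = ℕ.≤-refl
    ... | no  _ = ℕ.m≤n⇒m≤1+n (νr-search-≤ j)

    νr-search-greatest : ∀ {i} j → i ≤ j → r ^ i ℕ.∣ ∣ d ∣ → i ≤ νr-search r e d j
    νr-search-greatest {zero}  j       _   _   = z≤n
    νr-search-greatest {suc i} (suc j) i≤j rⁱ∣d with r ^ suc j ℕ.∣? ∣ d ∣
    ... | yes _ = i≤j
    ... | no rʲ⁺¹∤d with ℕ.m≤n⇒m<n∨m≡n i≤j
    ...   | inj₁ i<j   = νr-search-greatest j (ℕ.≤-pred i<j) rⁱ∣d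
    ...   | inj₂ refl = contradiction rⁱ∣d rʲ⁺¹∤d

  νr-∣ : ∀ r e d → + (r ^ νr r e d) ∣ d
  νr-∣ r e d = ∣ᵤ⇒∣ (νr-search-∣ r e d e)

  νr-≤ : ∀ r e d → νr r e d ≤ e
  νr-≤ r e d = νr-search-≤ r e d e

  νr-greatest : ∀ {r e d i} → i ≤ e → + (r ^ i) ∣ d → i ≤ νr r e d
  νr-greatest {r} {e} {d} i≤e rⁱ∣d = νr-search-greatest r e d e i≤e (∣⇒∣ᵤ rⁱ∣d)

  foldr-⊓-≤ : ∀ {A : Set} e (f : A → ℕ) {z xs} → z ∈ xs → foldr _⊓_ e (map f xs) ≤ f z
  foldr-⊓-≤ e f (here refl) = ℕ.m⊓n≤m _ _
  foldr-⊓-≤ e f (there z∈xs) = ℕ.≤-trans (ℕ.m⊓n≤n _ _) (foldr-⊓-≤ e f z∈xs)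

  ≤-foldr-⊓ : ∀ {A : Set} {h} e (f : A → ℕ) xs → h ≤ e → (∀ z → h ≤ f z) → h ≤ foldr _⊓_ e (map f xs)
  ≤-foldr-⊓ e f []       h≤e _   = h≤e
  ≤-foldr-⊓ e f (x ∷ xs) h≤e h≤f = ℕ.⊓-glb (h≤f x) (≤-foldr-⊓ e f xs h≤e h≤f)

  residue-pairs : ℕ → List (ℕ × ℕ)
  residue-pairs m = concatMap (λ x → map (x ,_) (upTo m)) (upTo m)

  ∈-residue-pairs : ∀ {m x y} → x < m → y < m → (x , y) ∈ residue-pairs m
  ∈-residue-pairs {m} {x} x<m y<m =
    ∈-concatMap⁺ (λ x → map (x ,_) (upTo m)) (Any.map (λ { refl → ∈-map⁺ (x ,_) (∈-upTo⁺ y<m) }) (∈-upTo⁺ x<m))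

  if-∧-≤ : ∀ {P Q : Set} {h a b} (P? : Dec P) (Q? : Dec Q) → (P → Q → h ≤ a) → h ≤ b →
           h ≤ (if does P? ∧ does Q? then a else b)
  if-∧-≤ (yes p) (yes q) h≤a _   = h≤a p q
  if-∧-≤ (yes _) (no _)  _   h≤b = h≤b
  if-∧-≤ (no _)  _       _   h≤b = h≤b

  module _ {N k r e : ℕ} where

    νa≤νr : ∀ {a x y} → InP N (r ^ e) k a x y → νa N k r e a ≤ νr r e (+ (k ℕ.* x) - + y)
    νa≤νr {a} {x} {y} ((x<m , y<m , xy≡N) , a≡kx+y) = ℕ.≤-trans (foldr-⊓-≤ e _ (∈-residue-pairs x<m y<m))
      (ℕ.≤-reflexive (cong₂ (λ b c → if b ∧ c then νr r e (+ (k ℕ.* x) - + y) else e)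
        (dec-true ((+ (x ℕ.* y)) ≡? (+ N) [mod r ^ e ]) xy≡N)
        (dec-true ((+ a) ≡? (+ (k ℕ.* x ℕ.+ y)) [mod r ^ e ]) a≡kx+y)))

    ≤νa : ∀ {a h} → h ≤ e →
          (∀ x y → (+ (x ℕ.* y)) ≡ (+ N) [mod r ^ e ] → (+ a) ≡ (+ (k ℕ.* x ℕ.+ y)) [mod r ^ e ] →
                   h ≤ νr r e (+ (k ℕ.* x) - + y)) →
          h ≤ νa N k r e a
    ≤νa {a} h≤e bound = ≤-foldr-⊓ e _ (residue-pairs (r ^ e)) h≤e λ (x , y) →
      if-∧-≤ ((+ (x ℕ.* y)) ≡? (+ N) [mod r ^ e ]) ((+ a) ≡? (+ (k ℕ.* x ℕ.+ y)) [mod r ^ e ]) (bound x y) h≤e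

  d≈u*rʰ⇒νr≤h : ∀ {r e h d u} .{{_ : NonZero r}} → d ≈ u * + (r ^ h) [mod r ^ e ] → ¬ (+ r ∣ u) → νr r e d ≤ h
  d≈u*rʰ⇒νr≤h {r} {e} {h} {d} {u} d≈urʰ r∤u with νr r e d ℕ.≤? h
  ... | yes νr≤h = νr≤h
  ... | no  νr≰h = contradiction r∣u r∤u
    where
    instance
      rʰ≢0 : NonZero (r ^ h)
      rʰ≢0 = ℕ.m^n≢0 r h
    h<νr : suc h ≤ νr r e d
    h<νr = ℕ.≰⇒> νr≰h
    rʰ⁺¹∣d : + (r ^ suc h) ∣ d
    rʰ⁺¹∣d = ∣-trans (ℕ∣⇒ℤ∣ (^-monoʳ-∣ r h<νr)) (νr-∣ r e d)
    rʰ⁺¹∣rᵉ : r ^ suc h ℕ.∣ r ^ e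
    rʰ⁺¹∣rᵉ = ^-monoʳ-∣ r (ℕ.≤-trans h<νr (νr-≤ r e d))
    r∣u : + r ∣ u
    r∣u = *-cancelʳ-∣ (+ (r ^ h))
            (subst (_∣ u * + (r ^ h)) (pos-* r (r ^ h)) (∣-resp-≈ rʰ⁺¹∣d (≈-weaken rʰ⁺¹∣rᵉ d≈urʰ)))

  module LargeValuation {N k r e : ℕ} (r-prime : Prime r) (2∤r : ¬ 2 ℕ.∣ r) (N*k⊥r : Coprime (N ℕ.* k) r) where

    open Quadratic (+ k) (+ N) public

    private
      instance
        r≢0 : NonZero r
        r≢0 = prime⇒nonZero r-prime
        rᵉ≢0 : NonZero (r ^ e)
        rᵉ≢0 = ℕ.m^n≢0 r e
      r∤N : ¬ (+ r ∣ + N)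
      r∤N = prime∤coprime r-prime N*k⊥r ∘ ℕ.∣m⇒∣m*n k ∘ ∣⇒∣ᵤ
      r∤k : ¬ (+ r ∣ + k)
      r∤k = prime∤coprime r-prime N*k⊥r ∘ ℕ.∣n⇒∣m*n N ∘ ∣⇒∣ᵤ
      r∤2 : ¬ (+ r ∣ + 2)
      r∤2 = odd-prime∤2 r-prime 2∤r ∘ ∣⇒∣ᵤ

    root-mod-r^e : ∀ {kinv} → 1 ≤ e → (+ (kinv ℕ.* k)) ≡ 1ℤ [mod r ] → legendre (+ (kinv ℕ.* N)) r ≡ 1ℤ →
                   ∃[ x ] + (r ^ e) ∣ F x
    root-mod-r^e {kinv} 1≤e kinv*k≡1 legendre≡1 with legendre≡1⇒square (+ (kinv ℕ.* N)) r legendre≡1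
    ... | x₀ , x₀²≡kinv*N with hensel-lift r-prime r∤2 r∤k r∤N {+ x₀} r∣Fx₀ (e ℕ.∸ 1)
      where
      r∣Fx₀ : + r ∣ F (+ x₀)
      r∣Fx₀ = inverse-square-root⇒root {w = + kinv} {+ x₀}
        (≈-trans (≈-reflexive (sym (pos-* kinv k))) (≡mod⇒≈ {a = + (kinv ℕ.* k)} {1ℤ} kinv*k≡1))
        (≈-trans (≡mod⇒≈ {a = + x₀ * + x₀} {+ (kinv ℕ.* N)} x₀²≡kinv*N) (≈-reflexive (pos-* kinv N)))
    ...   | x , root = x , subst (λ n → + (r ^ n) ∣ F x) (ℕ.m+[n∸m]≡n 1≤e) root

    kx-y-square : ∀ c x y → (+ (x ℕ.* y)) ≡ (+ N) [mod r ^ e ] → (+ c) ≡ (+ (k ℕ.* x ℕ.+ y)) [mod r ^ e ] →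
                  (+ (k ℕ.* x) - + y) * (+ (k ℕ.* x) - + y) ≈ + c * + c - + 4 * + k * + N [mod r ^ e ]
    kx-y-square c x y xy≡N c≡kx+y = begin
      (+ (k ℕ.* x) - + y) * (+ (k ℕ.* x) - + y)  ≡⟨ cong (λ t → (t - + y) * (t - + y)) (pos-* k x) ⟩
      (+ k * + x - + y) * (+ k * + x - + y)      ≈⟨ square-of-difference {X = + x} {+ y} {+ c} xy≈N c≈kx+y ⟩
      + c * + c - + 4 * + k * + N                ∎
      where
      open ≈-Reasoning (r ^ e)
      xy≈N : + x * + y ≈ + N [mod r ^ e ]
      xy≈N = ≈-trans (≈-reflexive (sym (pos-* x y))) (≡mod⇒≈ xy≡N)
      c≈kx+y : + c ≈ + k * + x + + y [mod r ^ e ]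
      c≈kx+y = ≈-trans (≡mod⇒≈ c≡kx+y) (≈-reflexive (pos-*+ k x y))

    large⇒square : ∀ {c} → InL N (r ^ e) k c → e ≤ 2 ℕ.* νa N k r e c → + c * + c ≈ + 4 * + k * + N [mod r ^ e ]
    large⇒square {c} (_ , x , y , xy∈H@(_ , _ , xy≡N) , kx+y≡c) e≤2νa =
      divides-diff (≈0⇒∣ (≈-trans (≈-sym (kx-y-square c x y xy≡N c≡kx+y)) D²≈0))
      where
      c≡kx+y : (+ c) ≡ (+ (k ℕ.* x ℕ.+ y)) [mod r ^ e ]
      c≡kx+y = ≈⇒≡mod (≈-sym (≡mod⇒≈ {a = + (k ℕ.* x ℕ.+ y)} {+ c} kx+y≡c))
      D : ℤ
      D = + (k ℕ.* x) - + y
      ⌈e/2⌉≤νr : ⌈ e /2⌉ ≤ νr r e D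
      ⌈e/2⌉≤νr = ℕ.≤-trans (m≤2*n⇒⌈m/2⌉≤n e≤2νa) (νa≤νr {N} {k} {r} {e} (xy∈H , c≡kx+y))
      rʰ∣D : + (r ^ ⌈ e /2⌉) ∣ D
      rʰ∣D = ∣-trans (ℕ∣⇒ℤ∣ (^-monoʳ-∣ r ⌈e/2⌉≤νr)) (νr-∣ r e D)
      D²≈0 : D * D ≈ 0ℤ [mod r ^ e ]
      D²≈0 = ∣⇒≈0 (∣-trans (m^n∣m^⌈n/2⌉*m^⌈n/2⌉ r e) (*-pres-∣ rʰ∣D rʰ∣D))

    square⇒large : ∀ {c} → + c * + c ≈ + 4 * + k * + N [mod r ^ e ] → ⌈ e /2⌉ ≤ νa N k r e c
    square⇒large {c} c²≈4kN = ≤νa {N} {k} {r} {e} (ℕ.⌈n/2⌉≤n e) λ x y xy≡N c≡kx+y →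
      νr-greatest (ℕ.⌈n/2⌉≤n e) (prime-power-∣-square-ℤ r-prime e
        (≈0⇒∣ (≈-trans (kx-y-square c x y xy≡N c≡kx+y) (∣⇒≈0 (∣-diff c²≈4kN)))))

    root-residue : ℤ → ℕ
    root-residue x = (+ 2 * + k * x) %ℕ r ^ e

    root-residue-neg : ∀ x → + root-residue (- x) ≈ - + root-residue x [mod r ^ e ]
    root-residue-neg x = begin
      + root-residue (- x)  ≈⟨ %ℕ-≈ (+ 2 * + k * (- x)) (r ^ e) ⟩
      + 2 * + k * (- x)     ≡⟨ neg-distribʳ-* (+ 2 * + k) x ⟨
      - (+ 2 * + k * x)     ≈⟨ -‿cong (%ℕ-≈ (+ 2 * + k * x) (r ^ e)) ⟨
      - + root-residue x    ∎
      where open ≈-Reasoning (r ^ e)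

    module _ {x : ℤ} (root : + (r ^ e) ∣ F x) where

      private
        a = root-residue x
        a≈2kx : + a ≈ + 2 * + k * x [mod r ^ e ]
        a≈2kx = %ℕ-≈ (+ 2 * + k * x) (r ^ e)
        P = + (r ^ ⌈ e /2⌉)
        x₁ = (x + P) %ℕ r ^ e
        y₁ = (+ k * (x - P)) %ℕ r ^ e
        x₁≈x+P : + x₁ ≈ x + P [mod r ^ e ]
        x₁≈x+P = %ℕ-≈ (x + P) (r ^ e)
        y₁≈k[x-P] : + y₁ ≈ + k * (x - P) [mod r ^ e ]
        y₁≈k[x-P] = %ℕ-≈ (+ k * (x - P)) (r ^ e)
        x₁y₁∈H : InH N (r ^ e) x₁ y₁
        x₁y₁∈H = n%ℕd<d (x + P) (r ^ e) , n%ℕd<d (+ k * (x - P)) (r ^ e) ,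
                 ≈⇒≡mod (≈-trans (≈-reflexive (pos-* x₁ y₁))
                                 (shifted-product x P x₁≈x+P y₁≈k[x-P] root (m^n∣m^⌈n/2⌉*m^⌈n/2⌉ r e)))
        kx₁+y₁≈a : + (k ℕ.* x₁ ℕ.+ y₁) ≈ + a [mod r ^ e ]
        kx₁+y₁≈a = ≈-trans (≈-reflexive (pos-*+ k x₁ y₁))
                           (≈-trans (shifted-sum x P x₁≈x+P y₁≈k[x-P]) (≈-sym a≈2kx))

      root-residue-square : + a * + a ≈ + 4 * + k * + N [mod r ^ e ]
      root-residue-square = root-square {A = + a} x root a≈2kx

      root-residue∈L : InL N (r ^ e) k a
      root-residue∈L = n%ℕd<d (+ 2 * + k * x) (r ^ e) , x₁ , y₁ , x₁y₁∈H , ≈⇒≡mod kx₁+y₁≈a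

      νa-root-residue : νa N k r e a ≡ ⌈ e /2⌉
      νa-root-residue = ℕ.≤-antisym (ℕ.≤-trans (νa≤νr {N} {k} {r} {e} x₁y₁∈P) νr≤⌈e/2⌉)
                                    (square⇒large {a} root-residue-square)
        where
        x₁y₁∈P : InP N (r ^ e) k a x₁ y₁
        x₁y₁∈P = x₁y₁∈H , ≈⇒≡mod (≈-sym kx₁+y₁≈a)
        νr≤⌈e/2⌉ : νr r e (+ (k ℕ.* x₁) - + y₁) ≤ ⌈ e /2⌉
        νr≤⌈e/2⌉ = d≈u*rʰ⇒νr≤h {e = e} {⌈ e /2⌉}
          (≈-trans (≈-reflexive (cong (_- + y₁) (pos-* k x₁))) (shifted-difference x P x₁≈x+P y₁≈k[x-P]))
          (prime-∤-* r-prime r∤2 r∤k)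

      root-residue-large : e ≤ 2 ℕ.* νa N k r e a
      root-residue-large = subst (λ n → e ≤ 2 ℕ.* n) (sym νa-root-residue) (n≤2*⌈n/2⌉ e)

      module _ (1≤e : 1 ≤ e) where

        private
          r∤2a : ¬ (+ r ∣ + 2 * + a)
          r∤2a r∣2a =
            prime-∤-* r-prime r∤2 r∤2kx (∣-resp-≈ r∣2a (*-cong (≈-refl {a = + 2}) (≈-weaken (m∣m^n r 1≤e) a≈2kx)))
            where
            r∤2kx : ¬ (+ r ∣ + 2 * + k * x)
            r∤2kx = prime-∤-* r-prime (prime-∤-* r-prime r∤2 r∤k)
                      (root-∤ r-prime r∤2 r∤k r∤N {x} (∣-trans (ℕ∣⇒ℤ∣ (m∣m^n r 1≤e)) root))

        root-residues-≢ : a ≢ root-residue (- x)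
        root-residues-≢ a≡b = ≉-neg 1≤e r∤2a (≈-trans (≈-reflexive (cong +_ a≡b)) (root-residue-neg x))

        large⇒root-residue : ∀ c → InL N (r ^ e) k c → e ≤ 2 ℕ.* νa N k r e c → c ≡ a ⊎ c ≡ root-residue (- x)
        large⇒root-residue c c∈L e≤2νa = Sum.map
          (≈-residues⇒≡ c<rᵉ (n%ℕd<d (+ 2 * + k * x) (r ^ e)))
          (λ c≈-a → ≈-residues⇒≡ c<rᵉ (n%ℕd<d (+ 2 * + k * (- x)) (r ^ e))
                                       (≈-trans c≈-a (≈-sym (root-residue-neg x))))
          (square-roots-mod-prime-power r-prime e {+ a} {+ c} r∤2a (≈-trans c²≈4kN (≈-sym root-residue-square)))
          where
          c<rᵉ : c < r ^ e
          c<rᵉ = proj₁ c∈L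
          c²≈4kN : + c * + c ≈ + 4 * + k * + N [mod r ^ e ]
          c²≈4kN = large⇒square {c} c∈L e≤2νa

open import Data.Nat using (ℕ; _*_; _≤_; _^_; ⌈_/2⌉)
open import Data.Nat.Primality using (Prime)
open import Data.Nat.Divisibility using (_∣_)
open import Data.Nat.Coprimality using (Coprime)
open import Data.Integer using (+_; 1ℤ; -_)
open import Data.Product using (_×_; ∃-syntax; _,_)
open import Data.Sum using (_⊎_)
open import Relation.Nullary using (¬_)
open import Relation.Binary.PropositionalEquality using (_≡_; _≢_)

lemma7p3 : (N k e r kinv : ℕ) → Prime r → ¬ (2 ∣ r) → Coprime (N * k) r → 1 ≤ e
  → (+ (kinv * k)) ≡ 1ℤ [mod r ]
  → legendre (+ (kinv * N)) r ≡ 1ℤ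
  → ∃[ a ] ∃[ b ] (a ≢ b
      × InL N (r ^ e) k a × InL N (r ^ e) k b
      × e ≤ 2 * νa N k r e a × e ≤ 2 * νa N k r e b
      × (∀ c → InL N (r ^ e) k c → e ≤ 2 * νa N k r e c → c ≡ a ⊎ c ≡ b)
      × νa N k r e a ≡ ⌈ e /2⌉ × νa N k r e b ≡ ⌈ e /2⌉)
lemma7p3 N k e r kinv r-prime 2∤r N*k⊥r 1≤e kinv*k≡1 legendre≡1 =
  let open LargeValuation {N} {k} {r} {e} r-prime 2∤r N*k⊥r
      x , root = root-mod-r^e {kinv} 1≤e kinv*k≡1 legendre≡1
      root⁻ = neg-root x root
  in  root-residue x , root-residue (- x) , root-residues-≢ root 1≤e ,
      root-residue∈L root , root-residue∈L root⁻ ,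
      root-residue-large root , root-residue-large root⁻ ,
      large⇒root-residue root 1≤e ,
      νa-root-residue root , νa-root-residue root⁻
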